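{- For any additive group $G$ of order $k$ and any integer $h>k+1$, there exists a harmonious $(G,\{k^{h(h-k-1)},h^k\},hk(h-k))$-SDF.
   Context: For a multiset $B=\{b_1,\dots,b_k\}$ in an additive group, $\Delta B=\{b_i-b_j\mid i\ne j\}$ (multiset). A $(G,K,\lambda)$-SDF is a collection $\Sigma$ of multisets in $G$ with multiset of sizes $K$ such that the multiset union of the $\Delta B$, $B\in\Sigma$, is $\lambda$ copies of all of $G$ (including $0$); it is harmonious if its block sizes sum to $\lambda$. Exponential notation: $\{k_1^{\mu_1},k_2^{\mu_2}\}$ is the multiset containing $k_i$ with multiplicity $\mu_i$. -}

module Defs where

open import Level using (Level)
open import Algebra.Bundles using (AbelianGroup)
open import Data.Nat using (ℕ; _*_; _∸_; _+_; _<_)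
open import Data.Fin using (Fin; _≟_)
open import Data.Fin.Properties using ()
open import Data.List using (List; []; _∷_; length; lookup; allFin; concatMap; concat; replicate; map; filter)
open import Data.Nat.ListAction using (sum)
open import Data.List.Relation.Binary.Permutation.Propositional using (_↭_)
import Data.List.Relation.Binary.Permutation.Setoid as SPerm
open import Data.Product using (Σ; _×_; _,_)
open import Relation.Binary.PropositionalEquality using (_≡_)
open import Relation.Nullary using (¬_)
open import Relation.Nullary.Decidable using (¬?)

module _ {c ℓ : Level} (G : AbelianGroup c ℓ) where
  open AbelianGroup G

  Multiset : Set c
  Multiset = List Carrier

  _-ᴳ_ : Carrier → Carrier → Carrier
  x -ᴳ y = x ∙ (y ⁻¹)

  -- ΔB = { b_i - b_j | i ≠ j } as a multiset (all ordered pairs of distinct indices)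
  Δ : Multiset → Multiset
  Δ B = concatMap (λ i → map (λ j → lookup B i -ᴳ lookup B j)
                             (filter (λ j → ¬? (i ≟ j)) (allFin (length B))))
                  (allFin (length B))

  HasOrder : ℕ → Set (c Level.⊔ ℓ)
  HasOrder k = Σ (Fin k → Carrier) λ e →
      (∀ i j → e i ≈ e j → i ≡ j) × (∀ x → Σ (Fin k) λ i → e i ≈ x)

  _≋ₘ_ : Multiset → Multiset → Set (c Level.⊔ ℓ)
  _≋ₘ_ = SPerm._↭_ setoid

  -- (G,K,λ)-SDF: Σ is a collection of multisets with multiset of sizes K such
  -- that the union of the ΔB is λ copies of G (given by an enumeration e of G).
  IsSDF : {k : ℕ} → (Fin k → Carrier) → List ℕ → ℕ → List Multiset → Set (c Level.⊔ ℓ)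
  IsSDF {k} e K λ' Σs =
    (map length Σs ↭ K) × (concatMap Δ Σs ≋ₘ concat (replicate λ' (map e (allFin k))))

  IsHarmonious : List Multiset → ℕ → Set
  IsHarmonious Σs λ' = sum (map length Σs) ≡ λ'

_^^_,_^^_ : ℕ → ℕ → ℕ → ℕ → List ℕ
k₁ ^^ μ₁ , k₂ ^^ μ₂ = replicate μ₁ k₁ Data.List.++ replicate μ₂ k₂

-- Take as blocks x = h(h−k−1) − (h−k) copies of G, h−k copies of {0^k} and k copies of
-- {0^(h−k)} ∪ G: that is h(h−k−1) blocks of size k and k of size h, of total size hk(h−k).
-- Every row a − G of the difference table of G is again G, so ΔG together with the k
-- diagonal zeros a − a is k copies of G. Further Δ{0^m} is m(m−1) zeros, and Δ({0^m} ∪ G)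
-- is m(m−1) zeros, 2m copies of G (the differences ±(0 − g)) and one ΔG. For m = h−k the
-- zeros are exactly k times the number of copies of ΔG, so every ΔG absorbs k zeros and the
-- differences of all blocks make up hk(h−k) copies of G.

module Submission where

open import Defs
open import Level using (Level)
open import Algebra.Bundles using (AbelianGroup)
open import Relation.Binary.Bundles using (Setoid)
open import Data.Nat using (ℕ; zero; suc; _*_; _∸_; _+_; _<_)
open import Data.Nat.Properties using (m≤n⇒∃[o]m+o≡n; m+n∸m≡n; +-comm)
open import Data.Nat.Tactic.RingSolver using (solve-∀)
open import Data.Nat.ListAction using (sum)
open import Data.Nat.ListAction.Properties using (sum-++)
open import Data.Fin using (Fin; zero; suc; _≟_)
open import Data.Fin.Properties using (¬Fin0)
open import Data.Empty using (⊥-elim)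
open import Data.Bool using (true; false)
open import Data.List using (List; []; _∷_; _++_; length; lookup; allFin; concatMap; concat; replicate; map; filter; tabulate)
import Data.List.Properties as List
open import Data.Product using (Σ; ∃-syntax; _×_; _,_; proj₁; proj₂)
open import Function using (id; _∘_; mk⇔)
open import Relation.Nullary using (does)
open import Relation.Nullary.Decidable using (¬?)
open import Relation.Binary.PropositionalEquality as ≡ using (_≡_; cong; cong₂)
import Data.List.Relation.Binary.Permutation.Setoid as Perm
import Data.List.Relation.Binary.Permutation.Propositional as PropPerm
open import Data.List.Relation.Binary.BagAndSetEquality using (∼bag⇒↭)
open import Data.List.Membership.Propositional using (_∈_)
open import Data.List.Membership.Propositional.Properties using (∈-map⁺; ∈-allFin)
open import Data.List.Membership.Propositional.Properties.WithK using (unique∧set⇒bag)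
import Data.List.Relation.Unary.Unique.Propositional.Properties as Unique
import Data.List.Relation.Binary.Pointwise as Pointwise
import Data.List.Relation.Binary.Permutation.Setoid.Properties as PermProperties

filter-≢zero-map-suc : ∀ {n} (xs : List (Fin n)) →
  filter (λ j → ¬? (zero ≟ j)) (map suc xs) ≡ map suc xs
filter-≢zero-map-suc [] = ≡.refl
filter-≢zero-map-suc (x ∷ xs) = cong (suc x ∷_) (filter-≢zero-map-suc xs)

filter-≢suc-map-suc : ∀ {n} (i : Fin n) (xs : List (Fin n)) →
  filter (λ j → ¬? (suc i ≟ j)) (map suc xs) ≡ map suc (filter (λ j → ¬? (i ≟ j)) xs)
filter-≢suc-map-suc i [] = ≡.refl
filter-≢suc-map-suc i (x ∷ xs) with does (i ≟ x)
... | true  = filter-≢suc-map-suc i xs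
... | false = cong (suc x ∷_) (filter-≢suc-map-suc i xs)

allFin-suc : ∀ n → allFin (suc n) ≡ zero ∷ map suc (allFin n)
allFin-suc n = cong (zero ∷_) (≡.sym (List.map-tabulate id suc))

map-lookup-allFin : ∀ {a b} {A : Set a} {B : Set b} (g : A → B) (xs : List A) →
  map (g ∘ lookup xs) (allFin (length xs)) ≡ map g xs
map-lookup-allFin g xs = ≡.trans (List.map-tabulate id _) (tabulate-lookup xs)
  where
  tabulate-lookup : ∀ xs → tabulate (g ∘ lookup xs) ≡ map g xs
  tabulate-lookup [] = ≡.refl
  tabulate-lookup (x ∷ xs) = cong (g x ∷_) (tabulate-lookup xs)

pairs-suc : ∀ n → n + (n + n * (n ∸ 1)) ≡ suc n * n
pairs-suc zero = ≡.refl
pairs-suc (suc n) = square-expansion n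
  where
  square-expansion : ∀ n → suc n + (suc n + suc n * n) ≡ suc (suc n) * suc n
  square-expansion = solve-∀

copies : ∀ {a} {A : Set a} → ℕ → List A → List A
copies n xs = concat (replicate n xs)

copies-+ : ∀ {a} {A : Set a} m n (xs : List A) → copies (m + n) xs ≡ copies m xs ++ copies n xs
copies-+ zero n xs = ≡.refl
copies-+ (suc m) n xs = ≡.trans (cong (xs ++_) (copies-+ m n xs)) (≡.sym (List.++-assoc xs _ _))

copies-* : ∀ {a} {A : Set a} m n (xs : List A) → copies (m * n) xs ≡ copies m (copies n xs)
copies-* zero n xs = ≡.refl
copies-* (suc m) n xs = ≡.trans (copies-+ n (m * n) xs) (cong (copies n xs ++_) (copies-* m n xs))

replicate-+ : ∀ {a} {A : Set a} m n (x : A) → replicate (m + n) x ≡ replicate m x ++ replicate n x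
replicate-+ zero n x = ≡.refl
replicate-+ (suc m) n x = cong (x ∷_) (replicate-+ m n x)

replicate-* : ∀ {a} {A : Set a} m n (x : A) → replicate (m * n) x ≡ copies m (replicate n x)
replicate-* zero n x = ≡.refl
replicate-* (suc m) n x = ≡.trans (replicate-+ n (m * n) x) (cong (replicate n x ++_) (replicate-* m n x))

copies-[] : ∀ {a} {A : Set a} n → copies {A = A} n [] ≡ []
copies-[] zero = ≡.refl
copies-[] (suc n) = copies-[] n

map-const : ∀ {a b} {A : Set a} {B : Set b} (x : A) (ys : List B) → map (λ _ → x) ys ≡ replicate (length ys) x
map-const x [] = ≡.refl
map-const x (_ ∷ ys) = cong (x ∷_) (map-const x ys)

concatMap-replicate : ∀ {a b} {A : Set a} {B : Set b} (f : A → List B) n x →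
  concatMap f (replicate n x) ≡ copies n (f x)
concatMap-replicate f n x = cong concat (List.map-replicate f n x)

sum-replicate : ∀ n m → sum (replicate n m) ≡ n * m
sum-replicate zero m = ≡.refl
sum-replicate (suc n) m = cong (m +_) (sum-replicate n m)

map-permutes-allFin : ∀ {n} (π : Fin n → Fin n) → (∀ {i j} → π i ≡ π j → i ≡ j) →
  (∀ i → ∃[ j ] π j ≡ i) → map π (allFin n) PropPerm.↭ allFin n
map-permutes-allFin {n} π π-injective π-surjective =
  ∼bag⇒↭ (unique∧set⇒bag (Unique.map⁺ π-injective (Unique.allFin⁺ n)) (Unique.allFin⁺ n)
    (λ {i} → mk⇔ (λ _ → ∈-allFin i)
      (λ _ → ≡.subst (_∈ map π (allFin n)) (proj₂ (π-surjective i)) (∈-map⁺ π (∈-allFin _)))))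

module MultisetAlgebra {c ℓ : Level} (S : Setoid c ℓ) where
  open Setoid S using (_≈_) renaming (Carrier to A)
  open Perm S
  open PermProperties S
  open import Algebra.Solver.CommutativeMonoid ++-commutativeMonoid using (solve; _⊜_; _⊕_)

  copies⁺ : ∀ n {xs ys} → xs ↭ ys → copies n xs ↭ copies n ys
  copies⁺ zero p = ↭-refl
  copies⁺ (suc n) p = ++⁺ p (copies⁺ n p)

  ++-interchange : ∀ ws xs ys zs → (ws ++ xs) ++ (ys ++ zs) ↭ (ws ++ ys) ++ (xs ++ zs)
  ++-interchange = solve 4 (λ ws xs ys zs → (ws ⊕ xs) ⊕ (ys ⊕ zs) ⊜ (ws ⊕ ys) ⊕ (xs ⊕ zs)) ↭-refl

  copies-++ : ∀ n xs ys → copies n (xs ++ ys) ↭ copies n xs ++ copies n ys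
  copies-++ zero xs ys = ↭-refl
  copies-++ (suc n) xs ys =
    ↭-trans (++⁺ˡ (xs ++ ys) (copies-++ n xs ys)) (++-interchange xs ys (copies n xs) (copies n ys))

  map-cong-≈ : ∀ {a} {I : Set a} {f g : I → A} → (∀ i → f i ≈ g i) → ∀ is → map f is ↭ map g is
  map-cong-≈ f≈g is = ↭-reflexive-≋ (Pointwise.map⁺ _ _ (Pointwise.refl (λ {i} → f≈g i)))

  concatMap-const-↭ : ∀ {a} {I : Set a} {g : I → List A} {ys} → (∀ i → g i ↭ ys) →
    ∀ is → concatMap g is ↭ copies (length is) ys
  concatMap-const-↭ g↭ys [] = ↭-refl
  concatMap-const-↭ g↭ys (i ∷ is) = ++⁺ (g↭ys i) (concatMap-const-↭ g↭ys is)

  concatMap-∷ : ∀ {a} {I : Set a} (f : I → A) (g : I → List A) is →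
    concatMap (λ i → f i ∷ g i) is ↭ map f is ++ concatMap g is
  concatMap-∷ f g [] = ↭-refl
  concatMap-∷ f g (i ∷ is) =
    ↭-prep (f i) (↭-trans (++⁺ˡ (g i) (concatMap-∷ f g is)) (shifts (g i) (map f is)))

module Differences {c ℓ : Level} (G : AbelianGroup c ℓ) where
  open AbelianGroup G
  open Perm setoid
  open PermProperties setoid
  open MultisetAlgebra setoid

  Δ-row : (B : List Carrier) → Fin (length B) → List Carrier
  Δ-row B i = map (λ j → lookup B i - lookup B j) (filter (λ j → ¬? (i ≟ j)) (allFin (length B)))

  Δ-row-zero : ∀ a B → Δ-row (a ∷ B) zero ≡ map (a -_) B
  Δ-row-zero a B = begin
    map (λ j → a - lookup (a ∷ B) j) (filter (λ j → ¬? (zero ≟ j)) (allFin (suc (length B))))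
      ≡⟨ cong (map (λ j → a - lookup (a ∷ B) j) ∘ filter (λ j → ¬? (zero ≟ j))) (allFin-suc (length B)) ⟩
    map (λ j → a - lookup (a ∷ B) j) (filter (λ j → ¬? (zero ≟ j)) (map suc (allFin (length B))))
      ≡⟨ cong (map (λ j → a - lookup (a ∷ B) j)) (filter-≢zero-map-suc (allFin (length B))) ⟩
    map (λ j → a - lookup (a ∷ B) j) (map suc (allFin (length B)))
      ≡⟨ List.map-∘ (allFin (length B)) ⟨
    map (λ j → a - lookup B j) (allFin (length B))
      ≡⟨ map-lookup-allFin (a -_) B ⟩
    map (a -_) B ∎
    where open ≡.≡-Reasoning

  Δ-row-suc : ∀ a B i → Δ-row (a ∷ B) (suc i) ≡ (lookup B i - a) ∷ Δ-row B i
  Δ-row-suc a B i = begin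
    map f (filter (λ j → ¬? (suc i ≟ j)) (allFin (suc (length B))))
      ≡⟨ cong (map f ∘ filter (λ j → ¬? (suc i ≟ j))) (allFin-suc (length B)) ⟩
    (lookup B i - a) ∷ map f (filter (λ j → ¬? (suc i ≟ j)) (map suc (allFin (length B))))
      ≡⟨ cong ((lookup B i - a) ∷_) (cong (map f) (filter-≢suc-map-suc i (allFin (length B)))) ⟩
    (lookup B i - a) ∷ map f (map suc (filter (λ j → ¬? (i ≟ j)) (allFin (length B))))
      ≡⟨ cong ((lookup B i - a) ∷_) (List.map-∘ _) ⟨
    (lookup B i - a) ∷ Δ-row B i ∎
    where
    open ≡.≡-Reasoning
    f : Fin (suc (length B)) → Carrier
    f j = lookup B i - lookup (a ∷ B) j

  Δ-cons : ∀ a B → Δ G (a ∷ B) ↭ map (a -_) B ++ map (_- a) B ++ Δ G B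
  Δ-cons a B = begin
    concatMap (Δ-row (a ∷ B)) (allFin (suc n))
      ≡⟨ cong (concatMap (Δ-row (a ∷ B))) (allFin-suc n) ⟩
    Δ-row (a ∷ B) zero ++ concatMap (Δ-row (a ∷ B)) (map suc (allFin n))
      ≡⟨ cong₂ _++_ (Δ-row-zero a B) (≡.trans (List.concatMap-map (Δ-row (a ∷ B)) suc (allFin n))
                                              (List.concatMap-cong (Δ-row-suc a B) (allFin n))) ⟩
    map (a -_) B ++ concatMap (λ i → (lookup B i - a) ∷ Δ-row B i) (allFin n)
      ↭⟨ ++⁺ˡ (map (a -_) B) (concatMap-∷ (λ i → lookup B i - a) (Δ-row B) (allFin n)) ⟩
    map (a -_) B ++ map (λ i → lookup B i - a) (allFin n) ++ Δ G B
      ≡⟨ cong (λ xs → map (a -_) B ++ xs ++ Δ G B) (map-lookup-allFin (_- a) B) ⟩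
    map (a -_) B ++ map (_- a) B ++ Δ G B ∎
    where
    open PermutationReasoning
    n = length B

  differences : List Carrier → List Carrier → List Carrier
  differences A B = concatMap (λ a → map (a -_) B) A

  Δ-++-diagonal : ∀ B → Δ G B ++ map (λ b → b - b) B ↭ differences B B
  Δ-++-diagonal [] = ↭-refl
  Δ-++-diagonal (a ∷ B) = begin
    Δ G (a ∷ B) ++ (a - a) ∷ map (λ b → b - b) B
      ↭⟨ ↭-shift (Δ G (a ∷ B)) (map (λ b → b - b) B) ⟩
    (a - a) ∷ Δ G (a ∷ B) ++ map (λ b → b - b) B
      ↭⟨ ↭-prep (a - a) (++⁺ʳ _ (Δ-cons a B)) ⟩
    (a - a) ∷ (map (a -_) B ++ map (_- a) B ++ Δ G B) ++ map (λ b → b - b) B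
      ≡⟨ cong ((a - a) ∷_) (reassociate (map (a -_) B) (map (_- a) B)) ⟩
    (a - a) ∷ map (a -_) B ++ map (_- a) B ++ Δ G B ++ map (λ b → b - b) B
      ↭⟨ ↭-prep (a - a) (++⁺ˡ (map (a -_) B) (++⁺ˡ (map (_- a) B) (Δ-++-diagonal B))) ⟩
    (a - a) ∷ map (a -_) B ++ map (_- a) B ++ differences B B
      ↭⟨ ↭-prep (a - a) (++⁺ˡ (map (a -_) B) (concatMap-∷ (_- a) (λ b → map (b -_) B) B)) ⟨
    differences (a ∷ B) (a ∷ B) ∎
    where
    open PermutationReasoning
    reassociate : ∀ xs ys {zs ws : List Carrier} → (xs ++ ys ++ zs) ++ ws ≡ xs ++ ys ++ zs ++ ws
    reassociate xs ys {zs} {ws} = ≡.trans (List.++-assoc xs _ ws) (cong (xs ++_) (List.++-assoc ys zs ws))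

  Δ-replicate-++ : ∀ m a B →
    Δ G (replicate m a ++ B) ↭
      replicate (m * (m ∸ 1)) (a - a) ++ copies m (map (a -_) B ++ map (_- a) B) ++ Δ G B
  Δ-replicate-++ zero a B = ↭-refl
  Δ-replicate-++ (suc n) a B = begin
    Δ G (a ∷ replicate n a ++ B)
      ↭⟨ Δ-cons a (replicate n a ++ B) ⟩
    map (a -_) (replicate n a ++ B) ++ map (_- a) (replicate n a ++ B) ++ Δ G (replicate n a ++ B)
      ≡⟨ cong₂ (λ xs ys → xs ++ ys ++ Δ G (replicate n a ++ B)) (map-replicate-++ (a -_)) (map-replicate-++ (_- a)) ⟩
    (d n ++ P) ++ (d n ++ Q) ++ Δ G (replicate n a ++ B)
      ↭⟨ ++⁺ˡ (d n ++ P) (++⁺ˡ (d n ++ Q) (Δ-replicate-++ n a B)) ⟩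
    (d n ++ P) ++ (d n ++ Q) ++ d (n * (n ∸ 1)) ++ copies n (P ++ Q) ++ Δ G B
      ↭⟨ regroup (d n) P Q (d (n * (n ∸ 1))) (copies n (P ++ Q)) (Δ G B) ⟩
    (d n ++ d n ++ d (n * (n ∸ 1))) ++ ((P ++ Q) ++ copies n (P ++ Q)) ++ Δ G B
      ≡⟨ cong (λ xs → xs ++ copies (suc n) (P ++ Q) ++ Δ G B) count-diagonal ⟩
    d (suc n * n) ++ copies (suc n) (P ++ Q) ++ Δ G B ∎
    where
    open PermutationReasoning
    open import Algebra.Solver.CommutativeMonoid ++-commutativeMonoid using (solve; _⊜_; _⊕_)
    d : ℕ → List Carrier
    d l = replicate l (a - a)
    P = map (a -_) B
    Q = map (_- a) B
    map-replicate-++ : ∀ f → map f (replicate n a ++ B) ≡ replicate n (f a) ++ map f B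
    map-replicate-++ f = ≡.trans (List.map-++ f (replicate n a) B) (cong (_++ map f B) (List.map-replicate f n a))
    regroup : ∀ ds p q es r s → (ds ++ p) ++ (ds ++ q) ++ es ++ r ++ s ↭ (ds ++ ds ++ es) ++ ((p ++ q) ++ r) ++ s
    regroup = solve 6 (λ ds p q es r s →
      (ds ⊕ p) ⊕ ((ds ⊕ q) ⊕ (es ⊕ (r ⊕ s))) ⊜ (ds ⊕ (ds ⊕ es)) ⊕ (((p ⊕ q) ⊕ r) ⊕ s)) ↭-refl
    count-diagonal : d n ++ d n ++ d (n * (n ∸ 1)) ≡ d (suc n * n)
    count-diagonal = ≡.trans (≡.sym (≡.trans (replicate-+ n _ (a - a)) (cong (d n ++_) (replicate-+ n _ (a - a)))))
                             (cong d (pairs-suc n))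

module FiniteGroup {c ℓ : Level} (G : AbelianGroup c ℓ) {k : ℕ} (e : Fin k → AbelianGroup.Carrier G)
  (e-injective : ∀ i j → AbelianGroup._≈_ G (e i) (e j) → i ≡ j)
  (e-surjective : ∀ x → Σ (Fin k) λ i → AbelianGroup._≈_ G (e i) x) where
  open AbelianGroup G renaming (sym to ≈-sym; trans to ≈-trans)
  open import Algebra.Properties.AbelianGroup G
  open Perm setoid
  open PermProperties setoid
  open MultisetAlgebra setoid
  open Differences G

  elements : List Carrier
  elements = map e (allFin k)

  length-elements : length elements ≡ k
  length-elements = ≡.trans (List.length-map e (allFin k)) (List.length-tabulate id)

  index : Carrier → Fin k
  index x = proj₁ (e-surjective x)

  e-index : ∀ x → e (index x) ≈ x
  e-index x = proj₂ (e-surjective x)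

  map-bijection↭elements : (f : Carrier → Carrier) →
    (∀ {x y} → x ≈ y → f x ≈ f y) → (∀ {x y} → f x ≈ f y → x ≈ y) → (∀ y → Σ Carrier λ x → f x ≈ y) →
    map f elements ↭ elements
  map-bijection↭elements f f-cong f-injective f-surjective = begin
    map f elements                ≡⟨ List.map-∘ (allFin k) ⟨
    map (f ∘ e) (allFin k)        ↭⟨ map-cong-≈ (λ i → ≈-sym (e-index (f (e i)))) (allFin k) ⟩
    map (e ∘ π) (allFin k)        ≡⟨ List.map-∘ (allFin k) ⟩
    map e (map π (allFin k))      ↭⟨ PermProperties.map⁺ (≡.setoid (Fin k)) setoid (reflexive ∘ cong e)
                                       (PropPerm.↭⇒↭ₛ (map-permutes-allFin π π-injective π-surjective)) ⟩
    elements ∎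
    where
    open PermutationReasoning
    π : Fin k → Fin k
    π i = index (f (e i))
    π-injective : ∀ {i j} → π i ≡ π j → i ≡ j
    π-injective {i} {j} πi≡πj = e-injective i j (f-injective
      (≈-trans (≈-sym (e-index (f (e i)))) (≈-trans (reflexive (cong e πi≡πj)) (e-index (f (e j))))))
    π-surjective : ∀ i → ∃[ j ] π j ≡ i
    π-surjective i = index x , e-injective _ i
      (≈-trans (e-index _) (≈-trans (f-cong (e-index x)) (proj₂ (f-surjective (e i)))))
      where x = proj₁ (f-surjective (e i))

  map-subtractedFrom↭elements : ∀ a → map (a -_) elements ↭ elements
  map-subtractedFrom↭elements a = map-bijection↭elements (a -_) (∙-congˡ ∘ ⁻¹-cong)
    (λ eq → ⁻¹-injective (∙-cancelˡ a _ _ eq)) (λ y → a - y , a-[a-y]≈y y)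
    where
    a-[a-y]≈y : ∀ y → a - (a - y) ≈ y
    a-[a-y]≈y y = ≈-trans (∙-congˡ (⁻¹-anti-homo‿- a y)) (≈-trans (≈-sym (assoc a y (a ⁻¹))) (xyx⁻¹≈y a y))

  map-minus↭elements : ∀ a → map (_- a) elements ↭ elements
  map-minus↭elements a =
    map-bijection↭elements (_- a) ∙-congʳ (∙-cancelʳ (a ⁻¹) _ _) (λ y → y ∙ a , //-rightDividesʳ a y)

  difference-table : differences elements elements ↭ copies k elements
  difference-table = ≡.subst (λ n → differences elements elements ↭ copies n elements) length-elements
    (concatMap-const-↭ map-subtractedFrom↭elements elements)

  Δ-elements-++-zeros : Δ G elements ++ replicate k ε ↭ copies k elements
  Δ-elements-++-zeros = begin
    Δ G elements ++ replicate k ε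
      ≡⟨ cong (λ n → Δ G elements ++ replicate n ε) length-elements ⟨
    Δ G elements ++ replicate (length elements) ε
      ≡⟨ cong (Δ G elements ++_) (map-const ε elements) ⟨
    Δ G elements ++ map (λ _ → ε) elements
      ↭⟨ ++⁺ˡ (Δ G elements) (map-cong-≈ (λ b → ≈-sym (inverseʳ b)) elements) ⟩
    Δ G elements ++ map (λ b → b - b) elements
      ↭⟨ Δ-++-diagonal elements ⟩
    differences elements elements
      ↭⟨ difference-table ⟩
    copies k elements ∎
    where open PermutationReasoning

  content : ℕ → ℕ → ℕ → List Carrier
  content a b c = copies a elements ++ replicate b ε ++ copies c (Δ G elements)

  content-+ : ∀ a b c a' b' c' → content a b c ++ content a' b' c' ↭ content (a + a') (b + b') (c + c')
  content-+ a b c a' b' c' = begin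
    content a b c ++ content a' b' c'
      ↭⟨ regroup (copies a elements) (replicate b ε) (copies c (Δ G elements))
                 (copies a' elements) (replicate b' ε) (copies c' (Δ G elements)) ⟩
    (copies a elements ++ copies a' elements) ++ (replicate b ε ++ replicate b' ε) ++
      (copies c (Δ G elements) ++ copies c' (Δ G elements))
      ≡⟨ cong₂ _++_ (copies-+ a a' elements) (cong₂ _++_ (replicate-+ b b' ε) (copies-+ c c' (Δ G elements))) ⟨
    content (a + a') (b + b') (c + c') ∎
    where
    open PermutationReasoning
    open import Algebra.Solver.CommutativeMonoid ++-commutativeMonoid using (solve; _⊜_; _⊕_)
    regroup : ∀ as bs cs as' bs' cs' → (as ++ bs ++ cs) ++ (as' ++ bs' ++ cs') ↭ (as ++ as') ++ (bs ++ bs') ++ (cs ++ cs')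
    regroup = solve 6 (λ as bs cs as' bs' cs' →
      (as ⊕ (bs ⊕ cs)) ⊕ (as' ⊕ (bs' ⊕ cs')) ⊜ (as ⊕ as') ⊕ ((bs ⊕ bs') ⊕ (cs ⊕ cs'))) ↭-refl

  copies-content : ∀ n {xs} a b c → xs ↭ content a b c → copies n xs ↭ content (n * a) (n * b) (n * c)
  copies-content zero a b c xs↭ = ↭-refl
  copies-content (suc n) a b c xs↭ =
    ↭-trans (++⁺ xs↭ (copies-content n a b c xs↭)) (content-+ a b c (n * a) (n * b) (n * c))

  content-absorb : ∀ a c → content a (c * k) c ↭ copies (a + c * k) elements
  content-absorb a c = begin
    copies a elements ++ replicate (c * k) ε ++ copies c (Δ G elements)
      ≡⟨ cong (λ zs → copies a elements ++ zs ++ copies c (Δ G elements)) (replicate-* c k ε) ⟩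
    copies a elements ++ copies c (replicate k ε) ++ copies c (Δ G elements)
      ↭⟨ ++⁺ˡ (copies a elements) (++-comm (copies c (replicate k ε)) _) ⟩
    copies a elements ++ copies c (Δ G elements) ++ copies c (replicate k ε)
      ↭⟨ ++⁺ˡ (copies a elements) (copies-++ c (Δ G elements) (replicate k ε)) ⟨
    copies a elements ++ copies c (Δ G elements ++ replicate k ε)
      ↭⟨ ++⁺ˡ (copies a elements) (copies⁺ c Δ-elements-++-zeros) ⟩
    copies a elements ++ copies c (copies k elements)
      ≡⟨ ≡.trans (copies-+ a (c * k) elements) (cong (copies a elements ++_) (copies-* c k elements)) ⟨
    copies (a + c * k) elements ∎
    where open PermutationReasoning

  replicate-ε-ε : ∀ n → replicate n (ε - ε) ↭ replicate n ε
  replicate-ε-ε n = ↭-reflexive-≋ (Pointwise.replicate⁺ (inverseʳ ε) n)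

  Δ-elements : Δ G elements ↭ content 0 0 1
  Δ-elements = ↭-reflexive (≡.sym (List.++-identityʳ (Δ G elements)))

  Δ-zeros : ∀ m → Δ G (replicate m ε) ↭ content 0 (m * (m ∸ 1)) 0
  Δ-zeros m = begin
    Δ G (replicate m ε)
      ≡⟨ cong (Δ G) (List.++-identityʳ (replicate m ε)) ⟨
    Δ G (replicate m ε ++ [])
      ↭⟨ Δ-replicate-++ m ε [] ⟩
    replicate (m * (m ∸ 1)) (ε - ε) ++ copies m [] ++ []
      ≡⟨ cong (λ xs → replicate (m * (m ∸ 1)) (ε - ε) ++ xs ++ []) (copies-[] m) ⟩
    replicate (m * (m ∸ 1)) (ε - ε) ++ []
      ↭⟨ ++⁺ʳ [] (replicate-ε-ε (m * (m ∸ 1))) ⟩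
    content 0 (m * (m ∸ 1)) 0 ∎
    where open PermutationReasoning

  Δ-zeros-++-elements : ∀ m → Δ G (replicate m ε ++ elements) ↭ content (m + m) (m * (m ∸ 1)) 1
  Δ-zeros-++-elements m = begin
    Δ G (replicate m ε ++ elements)
      ↭⟨ Δ-replicate-++ m ε elements ⟩
    replicate (m * (m ∸ 1)) (ε - ε) ++ copies m (map (ε -_) elements ++ map (_- ε) elements) ++ Δ G elements
      ↭⟨ ++⁺ (replicate-ε-ε (m * (m ∸ 1)))
             (++⁺ʳ (Δ G elements) (copies⁺ m (++⁺ (map-subtractedFrom↭elements ε) (map-minus↭elements ε)))) ⟩
    replicate (m * (m ∸ 1)) ε ++ copies m (elements ++ elements) ++ Δ G elements
      ↭⟨ ++⁺ˡ (replicate (m * (m ∸ 1)) ε) (++⁺ʳ (Δ G elements) (copies-++ m elements elements)) ⟩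
    replicate (m * (m ∸ 1)) ε ++ (copies m elements ++ copies m elements) ++ Δ G elements
      ≡⟨ cong (λ xs → replicate (m * (m ∸ 1)) ε ++ xs ++ Δ G elements) (copies-+ m m elements) ⟨
    replicate (m * (m ∸ 1)) ε ++ copies (m + m) elements ++ Δ G elements
      ↭⟨ shifts (replicate (m * (m ∸ 1)) ε) (copies (m + m) elements) ⟩
    copies (m + m) elements ++ replicate (m * (m ∸ 1)) ε ++ Δ G elements
      ≡⟨ cong (λ xs → copies (m + m) elements ++ replicate (m * (m ∸ 1)) ε ++ xs) (List.++-identityʳ (Δ G elements)) ⟨
    content (m + m) (m * (m ∸ 1)) 1 ∎
    where open PermutationReasoning

  blocks : ℕ → ℕ → List (List Carrier)
  blocks x m = replicate x elements ++ replicate m (replicate k ε) ++ replicate k (replicate m ε ++ elements)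

  length-blocks : ∀ x m → map length (blocks x m) ≡ replicate (x + m) k ++ replicate k (m + k)
  length-blocks x m = begin
    map length (blocks x m)
      ≡⟨ ≡.trans (List.map-++ length (replicate x elements) _)
                 (cong (map length (replicate x elements) ++_) (List.map-++ length (replicate m (replicate k ε)) _)) ⟩
    map length (replicate x elements) ++ map length (replicate m (replicate k ε)) ++
      map length (replicate k (replicate m ε ++ elements))
      ≡⟨ cong₂ _++_ (lengths x length-elements)
                    (cong₂ _++_ (lengths m (List.length-replicate k))
                                (lengths k (≡.trans (List.length-++ (replicate m ε))
                                                    (cong₂ _+_ (List.length-replicate m) length-elements)))) ⟩
    replicate x k ++ replicate m k ++ replicate k (m + k)
      ≡⟨ ≡.trans (cong (_++ replicate k (m + k)) (replicate-+ x m k)) (List.++-assoc (replicate x k) _ _) ⟨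
    replicate (x + m) k ++ replicate k (m + k) ∎
    where
    open ≡.≡-Reasoning
    lengths : ∀ n {xs : List Carrier} {l} → length xs ≡ l → map length (replicate n xs) ≡ replicate n l
    lengths n {xs} eq = ≡.trans (List.map-replicate length n xs) (cong (replicate n) eq)

  Δ-blocks : ∀ x m {n} → m * (k * (k ∸ 1)) + k * (m * (m ∸ 1)) ≡ (x + k) * k →
    k * (m + m) + (x + k) * k ≡ n → concatMap (Δ G) (blocks x m) ↭ copies n elements
  Δ-blocks x m {n} zero-count total = begin
    concatMap (Δ G) (blocks x m)
      ≡⟨ ≡.trans (List.concatMap-++ (Δ G) (replicate x elements) _)
                 (cong (concatMap (Δ G) (replicate x elements) ++_) (List.concatMap-++ (Δ G) (replicate m (replicate k ε)) _)) ⟩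
    concatMap (Δ G) (replicate x elements) ++ concatMap (Δ G) (replicate m (replicate k ε)) ++
      concatMap (Δ G) (replicate k (replicate m ε ++ elements))
      ≡⟨ cong₂ _++_ (concatMap-replicate (Δ G) x elements)
                    (cong₂ _++_ (concatMap-replicate (Δ G) m _) (concatMap-replicate (Δ G) k _)) ⟩
    copies x (Δ G elements) ++ copies m (Δ G (replicate k ε)) ++ copies k (Δ G (replicate m ε ++ elements))
      ↭⟨ ++⁺ (copies-content x 0 0 1 Δ-elements)
             (++⁺ (copies-content m 0 _ 0 (Δ-zeros k)) (copies-content k _ _ 1 (Δ-zeros-++-elements m))) ⟩
    content (x * 0) (x * 0) (x * 1) ++ content (m * 0) (m * p k) (m * 0) ++ content (k * (m + m)) (k * p m) (k * 1)
      ↭⟨ ++⁺ˡ (content (x * 0) (x * 0) (x * 1)) (content-+ (m * 0) (m * p k) (m * 0) (k * (m + m)) (k * p m) (k * 1)) ⟩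
    content (x * 0) (x * 0) (x * 1) ++ content (m * 0 + k * (m + m)) (m * p k + k * p m) (m * 0 + k * 1)
      ↭⟨ content-+ (x * 0) (x * 0) (x * 1) (m * 0 + k * (m + m)) (m * p k + k * p m) (m * 0 + k * 1) ⟩
    content (x * 0 + (m * 0 + k * (m + m))) (x * 0 + (m * p k + k * p m)) (x * 1 + (m * 0 + k * 1))
      ≡⟨ content-cong (≡.trans (drop-zeros x _) (drop-zeros m _)) (≡.trans (drop-zeros x _) zero-count)
                      (count-Δ x m k) ⟩
    content (k * (m + m)) ((x + k) * k) (x + k)
      ↭⟨ content-absorb (k * (m + m)) (x + k) ⟩
    copies (k * (m + m) + (x + k) * k) elements
      ≡⟨ cong (λ l → copies l elements) total ⟩
    copies n elements ∎
    where
    open PermutationReasoning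
    p : ℕ → ℕ
    p l = l * (l ∸ 1)
    content-cong : ∀ {a b c a' b' c'} → a ≡ a' → b ≡ b' → c ≡ c' → content a b c ≡ content a' b' c'
    content-cong ≡.refl ≡.refl ≡.refl = ≡.refl
    drop-zeros : ∀ y z → y * 0 + z ≡ z
    drop-zeros = solve-∀
    count-Δ : ∀ x m k → x * 1 + (m * 0 + k * 1) ≡ x + k
    count-Δ = solve-∀

  sum-length-blocks : ∀ x m → sum (map length (blocks x m)) ≡ (x + m) * k + k * (m + k)
  sum-length-blocks x m = begin
    sum (map length (blocks x m))                            ≡⟨ cong sum (length-blocks x m) ⟩
    sum (replicate (x + m) k ++ replicate k (m + k))         ≡⟨ sum-++ (replicate (x + m) k) _ ⟩
    sum (replicate (x + m) k) + sum (replicate k (m + k))    ≡⟨ cong₂ _+_ (sum-replicate (x + m) k) (sum-replicate k (m + k)) ⟩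
    (x + m) * k + k * (m + k)                                ∎
    where open ≡.≡-Reasoning

m+1<n⇒∃[o]n≡m+2+o : ∀ {m n} → m + 1 < n → ∃[ o ] n ≡ m + suc (suc o)
m+1<n⇒∃[o]n≡m+2+o {m} m+1<n with m≤n⇒∃[o]m+o≡n m+1<n
... | o , eq = o , ≡.trans (≡.sym eq) (shift m o)
  where
  shift : ∀ m o → suc (m + 1) + o ≡ m + suc (suc o)
  shift = solve-∀

lemma7p2 : ∀ {c ℓ : Level} (G : AbelianGroup c ℓ) (k : ℕ) (ord : HasOrder G k) (h : ℕ) →
    k + 1 < h →
    Σ (List (Multiset G)) λ Σs →
      IsSDF G (proj₁ ord) (k ^^ (h * (h ∸ k ∸ 1)) , h ^^ k) (h * k * (h ∸ k)) Σs
      × IsHarmonious G Σs (h * k * (h ∸ k))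
lemma7p2 G zero (_ , _ , e-surjective) h _ = ⊥-elim (¬Fin0 (proj₁ (e-surjective (AbelianGroup.ε G))))
lemma7p2 G (suc k') (e , e-injective , e-surjective) h k+1<h with m+1<n⇒∃[o]n≡m+2+o {suc k'} k+1<h
... | t , ≡.refl rewrite m+n∸m≡n (suc k') (suc (suc t)) =
  blocks x m ,
  (PropPerm.↭-reflexive lengths , Δ-blocks x m (zero-count k' t) (total k' t)) ,
  ≡.trans (sum-length-blocks x m) (harmonious k' t)
  where
  open FiniteGroup G e e-injective e-surjective
  k m x : ℕ
  k = suc k'
  m = suc (suc t)
  -- h(h−k−1) − (h−k), where h = k + m
  x = (k + t) * suc t + t
  lengths : map length (blocks x m) ≡ replicate ((k + m) * suc t) k ++ replicate k (k + m)
  lengths = ≡.trans (length-blocks x m) (cong₂ (λ a b → replicate a k ++ replicate k b) (size-k-blocks k' t) (+-comm m k))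
    where
    size-k-blocks : ∀ k' t → (suc k' + t) * suc t + t + suc (suc t) ≡ (suc k' + suc (suc t)) * suc t
    size-k-blocks = solve-∀
  zero-count : ∀ k' t →
    suc (suc t) * (suc k' * k') + suc k' * (suc (suc t) * suc t) ≡ ((suc k' + t) * suc t + t + suc k') * suc k'
  zero-count = solve-∀
  total : ∀ k' t → suc k' * (suc (suc t) + suc (suc t)) + ((suc k' + t) * suc t + t + suc k') * suc k'
                  ≡ (suc k' + suc (suc t)) * suc k' * suc (suc t)
  total = solve-∀
  harmonious : ∀ k' t → ((suc k' + t) * suc t + t + suc (suc t)) * suc k' + suc k' * (suc (suc t) + suc k')
                       ≡ (suc k' + suc (suc t)) * suc k' * suc (suc t)
  harmonious = solve-∀
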